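{- Let $n\ge 1$ and let $S,T\in\mathcal{L}_n$. Then \[ \mu_n(S,T)=\begin{cases}(-1)^{\rho(T)-\rho(S)} & \text{if } (S,T) \text{ is an elementary pair},\\ 0 & \text{otherwise.}\end{cases} \]
   Context: Let $[n]=\{1,\dots,n\}$ and $[k,n]=\{k,k+1,\dots,n\}$. The poset $\mathcal{L}_n$ is the set of all subsets of $[n]$ with the partial order $I\le_n J$ iff $\#(I\cap[k,n])\le\#(J\cap[k,n])$ for all $k=1,\dots,n$. For $I\subseteq[n]$ put $\rho(I)=\sum_{i\in I} i$. For $S,T\subseteq[n]$ put $\Delta_{S,T}(k)=\#(T\cap[k,n])-\#(S\cap[k,n])$. A pair $(S,T)$ of subsets of $[n]$ is called elementary if $\Delta_{S,T}(k)\in\{0,1\}$ for all $k=1,\dots,n$ and $\Delta_{S,T}(k)\cdot\Delta_{S,T}(k+1)=0$ for all $k=1,\dots,n-1$. $\mu_n$ denotes the Möbius function of $\mathcal{L}_n$: $\mu_n(x,x)=1$, $\mu_n(x,y)=0$ unless $x\le_n y$, and $\sum_{x\le_n z\le_n y}\mu_n(x,z)=0$ whenever $x<_n y$. -}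

module Defs where

open import Data.Bool using (Bool; true; false; if_then_else_; _∧_)
open import Data.Nat as ℕ using (ℕ; zero; suc; _≤_; _<_; _≤ᵇ_)
import Data.Nat.Properties as ℕP
open import Data.Integer as ℤ using (ℤ; +_; -_; ∣_∣)
open import Data.Fin using (Fin; toℕ)
open import Data.Fin.Properties using (all?)
open import Data.Fin.Subset using (Subset)
open import Data.Vec using (Vec; []; _∷_; lookup)
open import Data.List as List using (List; []; _∷_; allFin; filter; foldr)
open import Data.Product using (_×_; _,_)
open import Data.Sum using (_⊎_)
open import Relation.Nullary using (Dec; ¬_)
open import Relation.Nullary.Decidable using (_×-dec_)
open import Relation.Binary.PropositionalEquality using (_≡_; _≢_)

-- A subset of [n] is a Subset n = Vec Bool n; position i : Fin n
-- (0-based) represents the element (toℕ i + 1) of [n].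

sumℕ : List ℕ → ℕ
sumℕ = foldr ℕ._+_ 0

sumℤ : List ℤ → ℤ
sumℤ = foldr ℤ._+_ (+ 0)

-- #(I ∩ [k+1, n])  (k is 0-based: tailCount I k counts elements i+1 of I with i ≥ k)
tailCount : ∀ {n} → Subset n → ℕ → ℕ
tailCount {n} I k =
  sumℕ (List.map (λ i → if lookup I i ∧ (k ≤ᵇ toℕ i) then 1 else 0) (allFin n))

ρ : ∀ {n} → Subset n → ℕ
ρ {n} I = sumℕ (List.map (λ i → if lookup I i then suc (toℕ i) else 0) (allFin n))

_≤L_ : ∀ {n} → Subset n → Subset n → Set
_≤L_ {n} I J = (k : Fin n) → tailCount I (toℕ k) ≤ tailCount J (toℕ k)

_≤L?_ : ∀ {n} (I J : Subset n) → Dec (I ≤L J)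
I ≤L? J = all? (λ k → tailCount I (toℕ k) ℕP.≤? tailCount J (toℕ k))

_<L_ : ∀ {n} → Subset n → Subset n → Set
I <L J = I ≤L J × I ≢ J

allSubsets : (n : ℕ) → List (Subset n)
allSubsets zero = [] ∷ []
allSubsets (suc n) =
  List.map (true ∷_) (allSubsets n) List.++ List.map (false ∷_) (allSubsets n)

interval : ∀ {n} → Subset n → Subset n → List (Subset n)
interval {n} x y = filter (λ z → (x ≤L? z) ×-dec (z ≤L? y)) (allSubsets n)

-- μ is a Möbius function of 𝓛_n (the defining recursion; it determines μ uniquely)
IsMöbius : (n : ℕ) → (Subset n → Subset n → ℤ) → Set
IsMöbius n μ =
  ((x : Subset n) → μ x x ≡ + 1)
  × ((x y : Subset n) → ¬ (x ≤L y) → μ x y ≡ + 0)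
  × ((x y : Subset n) → x <L y → sumℤ (List.map (μ x) (interval x y)) ≡ + 0)

-- Δ_{S,T}(k+1) = #(T∩[k+1,n]) − #(S∩[k+1,n])   (k 0-based)
Δ : ∀ {n} → Subset n → Subset n → ℕ → ℤ
Δ S T k = + tailCount T k ℤ.- + tailCount S k

Elementary : ∀ {n} → Subset n → Subset n → Set
Elementary {n} S T =
  ((k : Fin n) → Δ S T (toℕ k) ≡ + 0 ⊎ Δ S T (toℕ k) ≡ + 1)
  × ((k : ℕ) → suc k < n → Δ S T k ℤ.* Δ S T (suc k) ≡ + 0)

-- (-1)^(ρ(T) − ρ(S)); the exponent is taken as |ρ(T) − ρ(S)|, same parity
signρ : ∀ {n} → Subset n → Subset n → ℤ
signρ S T = (- + 1) ℤ.^ ∣ + ρ T ℤ.- + ρ S ∣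

module Submission where

-- A subset I ⊆ [n] is a Boolean vector whose head records whether 1 ∈ I; dropping the head
-- passes to a subset of [2,n] ≅ [n-1].
--
-- The Möbius recursion determines μ uniquely: by induction on ρ(T), which strictly increases
-- along <, two solutions agree.  So it suffices to check that the claimed function
--   f(S,T) = (-1)^(ρ(T)-ρ(S)) if (S,T) is elementary, 0 otherwise
-- is itself a solution.  Elementary pairs are recognised by a two-state automaton δ that reads
-- S and T from n down to 1 and keeps Δ_{S,T}(k) ∈ {0,1} as its state.  The only non-trivial
-- identity is Σ_{S ≤ Z ≤ T} f(S,Z) = 0 for S < T.  Splitting this sum by the final state
-- Δ_{S,Z}(1) ∈ {0,1} into F₀ + F₁, we obtain a head recursion for the pair (F₀,F₁) and show by
-- induction that it equals (1,0) when S = T, and (1,-1) or (0,0) when S < T.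

open import Defs
open import Data.Nat using (ℕ; _≥_)
open import Data.Integer using (ℤ; +_)
open import Data.Fin.Subset using (Subset)
open import Data.Product using (_×_)
open import Relation.Nullary using (¬_)
open import Relation.Binary.PropositionalEquality using (_≡_)

open import Algebra.Properties.CommutativeSemigroup using (interchange)
open import Data.Bool using (Bool; true; false; if_then_else_; _∧_) renaming (_≟_ to _≟ᵇ_)
open import Data.Nat as ℕ using (zero; suc; _≤_; _<_; _≤ᵇ_; _∸_; z≤n; s≤s)
import Data.Nat.Properties as ℕP
open import Data.Integer as ℤ using (-_; ∣_∣)
import Data.Integer.Properties as ℤP
open import Data.Integer.Tactic.RingSolver using (solve-∀)
open import Data.Fin using (Fin; toℕ) renaming (zero to fzero; suc to fsuc)
open import Data.Vec using (Vec; []; _∷_; lookup)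
import Data.Vec.Properties as VecP
open import Data.List as List using (List; []; _∷_; _++_; allFin; filter)
import Data.List.Properties as ListP
open import Data.Maybe using (Maybe; just; nothing; maybe′; _>>=_)
open import Data.Product using (_,_; ∃)
open import Data.Sum using (_⊎_; inj₁; inj₂)
open import Data.Unit using (⊤; tt)
open import Function using (_∘_)
open import Relation.Nullary using (Dec; yes; no; does; contradiction)
open import Relation.Nullary.Decidable using (dec-true; dec-false; _×-dec_)
open import Relation.Binary.PropositionalEquality
  using (_≢_; refl; sym; trans; cong; cong₂; subst; subst₂; module ≡-Reasoning)

open ≡-Reasoning

sum-++ : ∀ {A : Set} (f : A → ℤ) (xs ys : List A) →
  sumℤ (List.map f (xs ++ ys)) ≡ sumℤ (List.map f xs) ℤ.+ sumℤ (List.map f ys)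
sum-++ f []       ys = sym (ℤP.+-identityˡ _)
sum-++ f (x ∷ xs) ys = trans (cong (ℤ._+_ (f x)) (sum-++ f xs ys)) (sym (ℤP.+-assoc (f x) _ _))

sum-cong : ∀ {A : Set} {f g : A → ℤ} → (∀ a → f a ≡ g a) →
  (xs : List A) → sumℤ (List.map f xs) ≡ sumℤ (List.map g xs)
sum-cong f≗g xs = cong sumℤ (ListP.map-cong f≗g xs)

sum-zero : ∀ {A : Set} (f : A → ℤ) → (∀ a → f a ≡ + 0) → (xs : List A) → sumℤ (List.map f xs) ≡ + 0
sum-zero f f≗0 []       = refl
sum-zero f f≗0 (x ∷ xs) = cong₂ ℤ._+_ (f≗0 x) (sum-zero f f≗0 xs)

sum-+ : ∀ {A : Set} (f g : A → ℤ) (xs : List A) →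
  sumℤ (List.map (λ a → f a ℤ.+ g a) xs) ≡ sumℤ (List.map f xs) ℤ.+ sumℤ (List.map g xs)
sum-+ f g []       = refl
sum-+ f g (x ∷ xs) = trans (cong (ℤ._+_ (f x ℤ.+ g x)) (sum-+ f g xs))
                           (interchange ℤP.+-commutativeSemigroup (f x) (g x) _ _)

sum-- : ∀ {A : Set} (f g : A → ℤ) (xs : List A) →
  sumℤ (List.map (λ a → f a ℤ.- g a) xs) ≡ sumℤ (List.map f xs) ℤ.- sumℤ (List.map g xs)
sum-- f g []       = refl
sum-- f g (x ∷ xs) = trans (cong (ℤ._+_ (f x ℤ.- g x)) (sum-- f g xs)) (regroup (f x) (g x) _ _)
  where
  regroup : ∀ a b c d → a ℤ.- b ℤ.+ (c ℤ.- d) ≡ a ℤ.+ c ℤ.- (b ℤ.+ d)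
  regroup = solve-∀

sum-* : ∀ {A : Set} (k : ℤ) (f : A → ℤ) (xs : List A) →
  sumℤ (List.map (λ a → k ℤ.* f a) xs) ≡ k ℤ.* sumℤ (List.map f xs)
sum-* k f []       = sym (ℤP.*-zeroʳ k)
sum-* k f (x ∷ xs) = trans (cong (ℤ._+_ (k ℤ.* f x)) (sum-* k f xs))
                           (sym (ℤP.*-distribˡ-+ k (f x) _))

sum-filter : ∀ {A : Set} {P : A → Set} (P? : (a : A) → Dec (P a)) (f : A → ℤ) (xs : List A) →
  sumℤ (List.map f (filter P? xs)) ≡ sumℤ (List.map (λ a → if does (P? a) then f a else + 0) xs)
sum-filter P? f []       = refl
sum-filter P? f (x ∷ xs) with does (P? x)
... | true  = cong (ℤ._+_ (f x)) (sum-filter P? f xs)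
... | false = trans (sum-filter P? f xs) (sym (ℤP.+-identityˡ _))

sumℕ-+ : ∀ {A : Set} (f g : A → ℕ) (xs : List A) →
  sumℕ (List.map (λ a → f a ℕ.+ g a) xs) ≡ sumℕ (List.map f xs) ℕ.+ sumℕ (List.map g xs)
sumℕ-+ f g []       = refl
sumℕ-+ f g (x ∷ xs) = trans (cong (ℕ._+_ (f x ℕ.+ g x)) (sumℕ-+ f g xs))
                            (interchange ℕP.+-commutativeSemigroup (f x) (g x) _ _)

sumℕ-allFin-suc : ∀ {n} (f : Fin (suc n) → ℕ) →
  sumℕ (List.map f (allFin (suc n))) ≡ f fzero ℕ.+ sumℕ (List.map (f ∘ fsuc) (allFin n))
sumℕ-allFin-suc f =
  cong (λ l → f fzero ℕ.+ sumℕ l)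
       (trans (ListP.map-tabulate fsuc f) (sym (ListP.map-tabulate (λ i → i) (f ∘ fsuc))))

Σs : ∀ {n} → (Subset n → ℤ) → ℤ
Σs {n} f = sumℤ (List.map f (allSubsets n))

Σs-split : ∀ {n} (f : Subset (suc n) → ℤ) →
  Σs f ≡ Σs (f ∘ (true ∷_)) ℤ.+ Σs (f ∘ (false ∷_))
Σs-split {n} f = begin
  sumℤ (List.map f (List.map (true ∷_) (allSubsets n) ++ List.map (false ∷_) (allSubsets n)))
    ≡⟨ sum-++ f (List.map (true ∷_) (allSubsets n)) (List.map (false ∷_) (allSubsets n)) ⟩
  sumℤ (List.map f (List.map (true ∷_) (allSubsets n)))
    ℤ.+ sumℤ (List.map f (List.map (false ∷_) (allSubsets n)))
    ≡⟨ sym (cong₂ ℤ._+_ (cong sumℤ (ListP.map-∘ (allSubsets n)))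
                        (cong sumℤ (ListP.map-∘ (allSubsets n)))) ⟩
  Σs (f ∘ (true ∷_)) ℤ.+ Σs (f ∘ (false ∷_)) ∎

Σs-point : ∀ {n} (h : Subset n → ℤ) (y : Subset n) → (∀ z → z ≢ y → h z ≡ + 0) → Σs h ≡ h y
Σs-point {zero}  h []        off-y = ℤP.+-identityʳ (h [])
Σs-point {suc n} h (true ∷ y) off-y = begin
  Σs h
    ≡⟨ Σs-split h ⟩
  Σs (h ∘ (true ∷_)) ℤ.+ Σs (h ∘ (false ∷_))
    ≡⟨ cong₂ ℤ._+_ (Σs-point _ y (λ z z≢y → off-y _ (z≢y ∘ VecP.∷-injectiveʳ)))
                   (sum-zero _ (λ z → off-y _ (λ ())) (allSubsets n)) ⟩
  h (true ∷ y) ℤ.+ + 0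
    ≡⟨ ℤP.+-identityʳ _ ⟩
  h (true ∷ y) ∎
Σs-point {suc n} h (false ∷ y) off-y = begin
  Σs h
    ≡⟨ Σs-split h ⟩
  Σs (h ∘ (true ∷_)) ℤ.+ Σs (h ∘ (false ∷_))
    ≡⟨ cong₂ ℤ._+_ (sum-zero _ (λ z → off-y _ (λ ())) (allSubsets n))
                   (Σs-point _ y (λ z z≢y → off-y _ (z≢y ∘ VecP.∷-injectiveʳ))) ⟩
  + 0 ℤ.+ h (false ∷ y)
    ≡⟨ ℤP.+-identityˡ _ ⟩
  h (false ∷ y) ∎

bit : Bool → ℕ
bit true  = 1
bit false = 0

size : ∀ {n} → Subset n → ℕ
size []      = 0
size (b ∷ v) = bit b ℕ.+ size v

-- ρ(I) = Σ_k #(I ∩ [k,n]): every element of the tail moves up by one in [n+1].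
weight : ∀ {n} → Subset n → ℕ
weight []      = 0
weight (b ∷ v) = size (b ∷ v) ℕ.+ weight v

tailTerm : ∀ {n} → Subset n → ℕ → Fin n → ℕ
tailTerm I k i = if lookup I i ∧ (k ≤ᵇ toℕ i) then 1 else 0

tailCount-cons-zero : ∀ {n} b (I : Subset n) → tailCount (b ∷ I) 0 ≡ bit b ℕ.+ tailCount I 0
tailCount-cons-zero true  I = sumℕ-allFin-suc (tailTerm (true ∷ I) 0)
tailCount-cons-zero false I = sumℕ-allFin-suc (tailTerm (false ∷ I) 0)

tailCount-cons-suc : ∀ {n} b (I : Subset n) k → tailCount (b ∷ I) (suc k) ≡ tailCount I k
tailCount-cons-suc true  I zero    = sumℕ-allFin-suc (tailTerm (true ∷ I) 1)
tailCount-cons-suc false I zero    = sumℕ-allFin-suc (tailTerm (false ∷ I) 1)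
tailCount-cons-suc true  I (suc k) = sumℕ-allFin-suc (tailTerm (true ∷ I) (suc (suc k)))
tailCount-cons-suc false I (suc k) = sumℕ-allFin-suc (tailTerm (false ∷ I) (suc (suc k)))

tailCount-zero : ∀ {n} (I : Subset n) → tailCount I 0 ≡ size I
tailCount-zero []      = refl
tailCount-zero (b ∷ I) = trans (tailCount-cons-zero b I) (cong (bit b ℕ.+_) (tailCount-zero I))

ρ-cons : ∀ {n} b (I : Subset n) → ρ (b ∷ I) ≡ size (b ∷ I) ℕ.+ ρ I
ρ-cons {n} b I = begin
  ρ (b ∷ I)
    ≡⟨ sumℕ-allFin-suc (λ i → if lookup (b ∷ I) i then suc (toℕ i) else 0) ⟩
  bit′ b ℕ.+ sumℕ (List.map (λ i → if lookup I i then suc (suc (toℕ i)) else 0) (allFin n))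
    ≡⟨ cong (bit′ b ℕ.+_) shifted ⟩
  bit′ b ℕ.+ (tailCount I 0 ℕ.+ ρ I)
    ≡⟨ cong₂ (λ u v → u ℕ.+ (v ℕ.+ ρ I)) (bit′≡bit b) (tailCount-zero I) ⟩
  bit b ℕ.+ (size I ℕ.+ ρ I)
    ≡⟨ sym (ℕP.+-assoc (bit b) (size I) (ρ I)) ⟩
  size (b ∷ I) ℕ.+ ρ I ∎
  where
  bit′ : Bool → ℕ
  bit′ c = if c then 1 else 0
  bit′≡bit : ∀ c → bit′ c ≡ bit c
  bit′≡bit true  = refl
  bit′≡bit false = refl
  split : ∀ i → (if lookup I i then suc (suc (toℕ i)) else 0)
              ≡ tailTerm I 0 i ℕ.+ (if lookup I i then suc (toℕ i) else 0)
  split i with lookup I i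
  ... | true  = refl
  ... | false = refl
  -- Σ_{i ∈ I} (i + 1) = #I + ρ(I), indices of I being shifted by one in b ∷ I.
  shifted : sumℕ (List.map (λ i → if lookup I i then suc (suc (toℕ i)) else 0) (allFin n))
          ≡ tailCount I 0 ℕ.+ ρ I
  shifted = trans (cong sumℕ (ListP.map-cong split (allFin n)))
                  (sumℕ-+ (tailTerm I 0) (λ i → if lookup I i then suc (toℕ i) else 0) (allFin n))

ρ≡weight : ∀ {n} (I : Subset n) → ρ I ≡ weight I
ρ≡weight []      = refl
ρ≡weight (b ∷ I) = trans (ρ-cons b I) (cong (size (b ∷ I) ℕ.+_) (ρ≡weight I))

_≼_ : ∀ {n} → Subset n → Subset n → Set
[]      ≼ []      = ⊤
(a ∷ x) ≼ (b ∷ y) = size (a ∷ x) ≤ size (b ∷ y) × x ≼ y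

_≼?_ : ∀ {n} (x y : Subset n) → Dec (x ≼ y)
[]      ≼? []      = yes tt
(a ∷ x) ≼? (b ∷ y) = (size (a ∷ x) ℕP.≤? size (b ∷ y)) ×-dec (x ≼? y)

≤L⇒≼ : ∀ {n} {x y : Subset n} → x ≤L y → x ≼ y
≤L⇒≼ {x = []}    {[]}    _   = tt
≤L⇒≼ {x = a ∷ x} {b ∷ y} x≤y =
    subst₂ _≤_ (tailCount-zero (a ∷ x)) (tailCount-zero (b ∷ y)) (x≤y fzero)
  , ≤L⇒≼ (λ k → subst₂ _≤_ (tailCount-cons-suc a x (toℕ k)) (tailCount-cons-suc b y (toℕ k))
                        (x≤y (fsuc k)))

≼⇒≤L : ∀ {n} {x y : Subset n} → x ≼ y → x ≤L y
≼⇒≤L {x = a ∷ x} {b ∷ y} (head≤ , _) fzero =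
  subst₂ _≤_ (sym (tailCount-zero (a ∷ x))) (sym (tailCount-zero (b ∷ y))) head≤
≼⇒≤L {x = a ∷ x} {b ∷ y} (_ , tail≤) (fsuc k) =
  subst₂ _≤_ (sym (tailCount-cons-suc a x (toℕ k))) (sym (tailCount-cons-suc b y (toℕ k)))
         (≼⇒≤L tail≤ k)

does-⇔ : ∀ {A B : Set} (a? : Dec A) (b? : Dec B) → (A → B) → (B → A) → does a? ≡ does b?
does-⇔ (yes a) b? A⇒B B⇒A = sym (dec-true b? (A⇒B a))
does-⇔ (no ¬a) b? A⇒B B⇒A = sym (dec-false b? (¬a ∘ B⇒A))

does-≤L : ∀ {n} (x y : Subset n) → does (x ≤L? y) ≡ does (x ≼? y)
does-≤L x y = does-⇔ (x ≤L? y) (x ≼? y) ≤L⇒≼ ≼⇒≤L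

_≟ₛ_ : ∀ {n} (x y : Subset n) → Dec (x ≡ y)
_≟ₛ_ = VecP.≡-dec _≟ᵇ_

-- ρ is strictly monotone along <; this is the rank for the induction in Möbius uniqueness.
≼-weight : ∀ {n} {z y : Subset n} → z ≼ y → weight z ≤ weight y
≼-weight {z = []}    {[]}    _              = z≤n
≼-weight {z = c ∷ z} {b ∷ y} (head≤ , tail≤) = ℕP.+-mono-≤ head≤ (≼-weight tail≤)

≼-weight< : ∀ {n} {z y : Subset n} → z ≼ y → z ≢ y → weight z < weight y
≼-weight< {z = []}    {[]}    _               z≢y = contradiction refl z≢y
≼-weight< {z = c ∷ z} {b ∷ y} (head≤ , tail≤) z≢y with z ≟ₛ y
... | no  tails≢  = ℕP.+-mono-≤-< head≤ (≼-weight< tail≤ tails≢)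
... | yes refl    = heads c b head≤ (z≢y ∘ cong (_∷ z))
  where
  heads : ∀ c b → size (c ∷ z) ≤ size (b ∷ z) → c ≢ b → weight (c ∷ z) < weight (b ∷ z)
  heads false true  _ _   = ℕP.n<1+n _
  heads true  false 1+s≤s _ = contradiction 1+s≤s ℕP.1+n≰n
  heads true  true  _ c≢b = contradiction refl c≢b
  heads false false _ c≢b = contradiction refl c≢b

cutoff : ∀ {P : Set} → Dec P → ℤ → ℤ
cutoff P? v = if does P? then v else + 0

cutoff-yes : ∀ {P : Set} (P? : Dec P) {v : ℤ} → P → cutoff P? v ≡ v
cutoff-yes (yes _) p = refl
cutoff-yes (no ¬p) p = contradiction p ¬p

cutoff-cong : ∀ {P : Set} (P? : Dec P) {u v : ℤ} → (P → u ≡ v) → cutoff P? u ≡ cutoff P? v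
cutoff-cong (yes p) u≡v = u≡v p
cutoff-cong (no _)  u≡v = refl

restrict : ∀ {n} (x y : Subset n) → (Subset n → ℤ) → Subset n → ℤ
restrict x y f z = cutoff ((x ≤L? z) ×-dec (z ≤L? y)) (f z)

interval-sum : ∀ {n} (x y : Subset n) (f : Subset n → ℤ) →
  sumℤ (List.map f (interval x y)) ≡ Σs (restrict x y f)
interval-sum {n} x y f = sum-filter (λ z → (x ≤L? z) ×-dec (z ≤L? y)) f (allSubsets n)

-- Induction on ρ(y): for x < y the interval sums vanish for both solutions, and their
-- summands agree except possibly at z = y (by the induction hypothesis, as ρ(z) < ρ(y)).
möbius-unique : ∀ {n} {μ ν : Subset n → Subset n → ℤ} → IsMöbius n μ → IsMöbius n ν →
  (x y : Subset n) → μ x y ≡ ν x y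
möbius-unique {n} {μ} {ν} (μ-refl , μ-zero , μ-sum) (ν-refl , ν-zero , ν-sum) x y =
  agree (suc (weight y)) y ℕP.≤-refl
  where
  agree : ∀ N y → weight y < N → μ x y ≡ ν x y
  agree (suc N) y ρy≤N with x ≤L? y | x ≟ₛ y
  ... | no  x≰y | _        = trans (μ-zero x y x≰y) (sym (ν-zero x y x≰y))
  ... | yes _   | yes refl = trans (μ-refl x) (sym (ν-refl x))
  ... | yes x≤y | no  x≢y  = ℤP.i-j≡0⇒i≡j _ _ (begin
      μ x y ℤ.- ν x y
        ≡⟨ sym (cong₂ ℤ._-_ (cutoff-yes (in-interval y) y∈[x,y])
                            (cutoff-yes (in-interval y) y∈[x,y])) ⟩
      difference y
        ≡⟨ sym (Σs-point difference y difference-off-y) ⟩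
      Σs difference
        ≡⟨ sum-- (restrict x y (μ x)) (restrict x y (ν x)) (allSubsets n) ⟩
      Σs (restrict x y (μ x)) ℤ.- Σs (restrict x y (ν x))
        ≡⟨ sym (cong₂ ℤ._-_ (interval-sum x y (μ x)) (interval-sum x y (ν x))) ⟩
      sumℤ (List.map (μ x) (interval x y)) ℤ.- sumℤ (List.map (ν x) (interval x y))
        ≡⟨ cong₂ ℤ._-_ (μ-sum x y (x≤y , x≢y)) (ν-sum x y (x≤y , x≢y)) ⟩
      + 0 ∎)
    where
    in-interval : ∀ z → Dec (x ≤L z × z ≤L y)
    in-interval z = (x ≤L? z) ×-dec (z ≤L? y)
    y∈[x,y] : x ≤L y × y ≤L y
    y∈[x,y] = x≤y , λ _ → ℕP.≤-refl
    difference : Subset n → ℤ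
    difference z = restrict x y (μ x) z ℤ.- restrict x y (ν x) z
    difference-off-y : ∀ z → z ≢ y → difference z ≡ + 0
    difference-off-y z z≢y = ℤP.i≡j⇒i-j≡0 (cutoff-cong (in-interval z) λ (_ , z≤y) →
      agree N z (ℕP.<-≤-trans (≼-weight< (≤L⇒≼ z≤y) z≢y) (ℕP.≤-pred ρy≤N)))

σ : ℕ → ℤ
σ k = (- + 1) ℤ.^ k

σ-+ : ∀ m k → σ (m ℕ.+ k) ≡ σ m ℤ.* σ k
σ-+ = ℤP.^-distribˡ-+-* (- + 1)

σ-square : ∀ m → σ m ℤ.* σ m ≡ + 1
σ-square zero    = refl
σ-square (suc m) = trans (cancel-signs (σ m)) (σ-square m)
  where
  cancel-signs : ∀ s → (- + 1 ℤ.* s) ℤ.* (- + 1 ℤ.* s) ≡ s ℤ.* s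
  cancel-signs = solve-∀

-- For b ≤ a, (-1)^(a-b) = (-1)^a (-1)^b, since (-1)^b is its own inverse.
σ-∸ : ∀ a b → b ≤ a → σ (a ∸ b) ≡ σ a ℤ.* σ b
σ-∸ a b b≤a = begin
  σ (a ∸ b)                       ≡⟨ sym (ℤP.*-identityʳ _) ⟩
  σ (a ∸ b) ℤ.* + 1               ≡⟨ cong (σ (a ∸ b) ℤ.*_) (sym (σ-square b)) ⟩
  σ (a ∸ b) ℤ.* (σ b ℤ.* σ b)     ≡⟨ sym (ℤP.*-assoc (σ (a ∸ b)) (σ b) (σ b)) ⟩
  σ (a ∸ b) ℤ.* σ b ℤ.* σ b       ≡⟨ cong (ℤ._* σ b) (sym (σ-+ (a ∸ b) b)) ⟩
  σ (a ∸ b ℕ.+ b) ℤ.* σ b         ≡⟨ cong (λ m → σ m ℤ.* σ b) (ℕP.m∸n+n≡m b≤a) ⟩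
  σ a ℤ.* σ b ∎

σ-∣-∣ : ∀ a b → σ ∣ + a ℤ.- + b ∣ ≡ σ a ℤ.* σ b
σ-∣-∣ a b with b ℕP.≤? a
... | yes b≤a = trans (cong (σ ∘ ∣_∣) (trans (ℤP.m-n≡m⊖n a b) (ℤP.⊖-≥ b≤a))) (σ-∸ a b b≤a)
... | no  b≰a = begin
  σ ∣ + a ℤ.- + b ∣  ≡⟨ cong (σ ∘ ∣_∣) (ℤP.m-n≡m⊖n a b) ⟩
  σ ∣ a ℤ.⊖ b ∣      ≡⟨ cong σ (ℤP.∣⊖∣-≤ a≤b) ⟩
  σ (b ∸ a)          ≡⟨ σ-∸ b a a≤b ⟩
  σ b ℤ.* σ a        ≡⟨ ℤP.*-comm (σ b) (σ a) ⟩
  σ a ℤ.* σ b ∎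
  where a≤b = ℕP.<⇒≤ (ℕP.≰⇒> b≰a)

sg : ∀ {n} → Subset n → Subset n → ℤ
sg x z = σ (weight z) ℤ.* σ (weight x)

signρ≡sg : ∀ {n} (x z : Subset n) → signρ x z ≡ sg x z
signρ≡sg x z = trans (σ-∣-∣ (ρ z) (ρ x)) (cong₂ (λ u v → σ u ℤ.* σ v) (ρ≡weight z) (ρ≡weight x))

-- One step of the recogniser: reading position k with a = [k ∈ S], c = [k ∈ T] and current
-- state d = Δ(k+1), the new state is Δ(k) = d + c − a.  The step fails unless
-- Δ(k) ∈ {0,1} and Δ(k)·Δ(k+1) = 0.
step : (a c d : Bool) → Maybe Bool
step false false false = just false
step true  true  false = just false
step false true  false = just true
step true  false true  = just false
step true  false false = nothing
step false false true  = nothing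
step false true  true  = nothing
step true  true  true  = nothing

-- δ S T = just Δ_{S,T}(1) if (S,T) is elementary, nothing otherwise.
δ : ∀ {n} → Subset n → Subset n → Maybe Bool
δ []      []      = just false
δ (a ∷ x) (c ∷ z) = δ x z >>= step a c

δ-refl : ∀ {n} (x : Subset n) → δ x x ≡ just false
δ-refl []      = refl
δ-refl (a ∷ x) rewrite δ-refl x with a
... | true  = refl
... | false = refl

δ-size : ∀ {n} (x z : Subset n) {d} → δ x z ≡ just d → size z ≡ bit d ℕ.+ size x
δ-size [] [] refl = refl
δ-size (a ∷ x) (c ∷ z) {d} accept with δ x z in tail-accept
... | just d′ = shift a c d′ accept (δ-size x z tail-accept)
  where
  shift : ∀ a c d′ → step a c d′ ≡ just d → size z ≡ bit d′ ℕ.+ size x →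
          bit c ℕ.+ size z ≡ bit d ℕ.+ (bit a ℕ.+ size x)
  shift false false false refl sz = sz
  shift true  true  false refl sz = cong suc sz
  shift false true  false refl sz = cong suc sz
  shift true  false true  refl sz = sz

δ⇒≼ : ∀ {n} (x z : Subset n) {d} → δ x z ≡ just d → x ≼ z
δ⇒≼ [] [] _ = tt
δ⇒≼ (a ∷ x) (c ∷ z) {d} accept with δ x z in tail-accept
... | just d′ = subst (λ s → size (a ∷ x) ≤ bit c ℕ.+ s) (sym (δ-size x z tail-accept))
                    (heads a c d′ accept)
              , δ⇒≼ x z tail-accept
  where
  heads : ∀ a c d′ → step a c d′ ≡ just d → bit a ℕ.+ size x ≤ bit c ℕ.+ (bit d′ ℕ.+ size x)
  heads false false false refl = ℕP.≤-refl
  heads true  true  false refl = ℕP.≤-refl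
  heads false true  false refl = ℕP.n≤1+n _
  heads true  false true  refl = ℕP.≤-refl

Δ₁ : ∀ {n} → Subset n → Subset n → ℤ
Δ₁ x z = + size z ℤ.- + size x

Δ-zero : ∀ {n} (x z : Subset n) → Δ x z 0 ≡ Δ₁ x z
Δ-zero x z = cong₂ (λ u v → + u ℤ.- + v) (tailCount-zero z) (tailCount-zero x)

Δ-cons-suc : ∀ {n} a c (x z : Subset n) k → Δ (a ∷ x) (c ∷ z) (suc k) ≡ Δ x z k
Δ-cons-suc a c x z k =
  cong₂ (λ u v → + u ℤ.- + v) (tailCount-cons-suc c z k) (tailCount-cons-suc a x k)

-- The conditions an elementary pair imposes at one position, given d = Δ(k), d′ = Δ(k+1).
LocallyElementary : ℤ → ℤ → Set
LocallyElementary d d′ = (d ≡ + 0 ⊎ d ≡ + 1) × d ℤ.* d′ ≡ + 0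

-- Elementary pairs on [n+1] are exactly the local conditions at 1 plus an elementary pair
-- on [2,n+1].  (For n = 0 the condition at 1 is vacuous since Δ₁ [] [] = 0.)
Elementary-head : ∀ {n} a c (x z : Subset n) → Elementary (a ∷ x) (c ∷ z) →
  LocallyElementary (Δ₁ (a ∷ x) (c ∷ z)) (Δ₁ x z)
Elementary-head a c [] [] (in01 , _) =
    subst (λ d → d ≡ + 0 ⊎ d ≡ + 1) (Δ-zero (a ∷ []) (c ∷ [])) (in01 fzero)
  , ℤP.*-zeroʳ (Δ₁ (a ∷ []) (c ∷ []))
Elementary-head a c x@(_ ∷ _) z@(_ ∷ _) (in01 , products) =
    subst (λ d → d ≡ + 0 ⊎ d ≡ + 1) (Δ-zero (a ∷ x) (c ∷ z)) (in01 fzero)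
  , subst₂ (λ u v → u ℤ.* v ≡ + 0) (Δ-zero (a ∷ x) (c ∷ z))
           (trans (Δ-cons-suc a c x z 0) (Δ-zero x z))
           (products 0 (s≤s (s≤s z≤n)))

Elementary-tail : ∀ {n} a c (x z : Subset n) → Elementary (a ∷ x) (c ∷ z) → Elementary x z
Elementary-tail a c x z (in01 , products) =
    (λ k → subst (λ d → d ≡ + 0 ⊎ d ≡ + 1) (Δ-cons-suc a c x z (toℕ k)) (in01 (fsuc k)))
  , (λ k k+1<n → subst₂ (λ u v → u ℤ.* v ≡ + 0) (Δ-cons-suc a c x z k)
                        (Δ-cons-suc a c x z (suc k)) (products (suc k) (s≤s k+1<n)))

Elementary-cons : ∀ {n} a c (x z : Subset n) →
  LocallyElementary (Δ₁ (a ∷ x) (c ∷ z)) (Δ₁ x z) → Elementary x z → Elementary (a ∷ x) (c ∷ z)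
Elementary-cons a c x z (head01 , head-product) (in01 , products) = in01′ , products′
  where
  in01′ : ∀ k → Δ (a ∷ x) (c ∷ z) (toℕ k) ≡ + 0 ⊎ Δ (a ∷ x) (c ∷ z) (toℕ k) ≡ + 1
  in01′ fzero    = subst (λ d → d ≡ + 0 ⊎ d ≡ + 1) (sym (Δ-zero (a ∷ x) (c ∷ z))) head01
  in01′ (fsuc k) = subst (λ d → d ≡ + 0 ⊎ d ≡ + 1) (sym (Δ-cons-suc a c x z (toℕ k))) (in01 k)
  products′ : ∀ k → suc k < suc _ → Δ (a ∷ x) (c ∷ z) k ℤ.* Δ (a ∷ x) (c ∷ z) (suc k) ≡ + 0
  products′ zero    _           =
    subst₂ (λ u v → u ℤ.* v ≡ + 0) (sym (Δ-zero (a ∷ x) (c ∷ z)))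
           (sym (trans (Δ-cons-suc a c x z 0) (Δ-zero x z))) head-product
  products′ (suc k) (s≤s k+1<n) =
    subst₂ (λ u v → u ℤ.* v ≡ + 0) (sym (Δ-cons-suc a c x z k))
           (sym (Δ-cons-suc a c x z (suc k))) (products k k+1<n)

Δ₁-state : ∀ {n} (x z : Subset n) {d′} → δ x z ≡ just d′ → Δ₁ x z ≡ + bit d′
Δ₁-state x z {d′} accept = begin
  + size z ℤ.- + size x                  ≡⟨ cong (λ s → + s ℤ.- + size x) (δ-size x z accept) ⟩
  + (bit d′ ℕ.+ size x) ℤ.- + size x     ≡⟨ cong (ℤ._- + size x) (ℤP.pos-+ (bit d′) (size x)) ⟩
  + bit d′ ℤ.+ + size x ℤ.- + size x     ≡⟨ cancel (+ bit d′) (+ size x) ⟩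
  + bit d′ ∎
  where
  cancel : ∀ d s → d ℤ.+ s ℤ.- s ≡ d
  cancel = solve-∀

Δ₁-cons : ∀ {n} a c (x z : Subset n) {d′} → δ x z ≡ just d′ →
  Δ₁ (a ∷ x) (c ∷ z) ≡ + (bit c ℕ.+ bit d′) ℤ.- + bit a
Δ₁-cons a c x z {d′} accept = begin
  + (bit c ℕ.+ size z) ℤ.- + (bit a ℕ.+ size x)
    ≡⟨ cong (λ s → + (bit c ℕ.+ s) ℤ.- + (bit a ℕ.+ size x)) (δ-size x z accept) ⟩
  + (bit c ℕ.+ (bit d′ ℕ.+ size x)) ℤ.- + (bit a ℕ.+ size x)
    ≡⟨ cong₂ ℤ._-_ (trans (ℤP.pos-+ (bit c) _)
                          (cong (ℤ._+_ (+ bit c)) (ℤP.pos-+ (bit d′) (size x))))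
                   (ℤP.pos-+ (bit a) (size x)) ⟩
  + bit c ℤ.+ (+ bit d′ ℤ.+ + size x) ℤ.- (+ bit a ℤ.+ + size x)
    ≡⟨ cancel (+ bit c) (+ bit d′) (+ bit a) (+ size x) ⟩
  + bit c ℤ.+ + bit d′ ℤ.- + bit a
    ≡⟨ cong (ℤ._- + bit a) (sym (ℤP.pos-+ (bit c) (bit d′))) ⟩
  + (bit c ℕ.+ bit d′) ℤ.- + bit a ∎
  where
  cancel : ∀ c d a s → c ℤ.+ (d ℤ.+ s) ℤ.- (a ℤ.+ s) ≡ c ℤ.+ d ℤ.- a
  cancel = solve-∀

step-sound : ∀ a c d′ {d} → step a c d′ ≡ just d →
  LocallyElementary (+ (bit c ℕ.+ bit d′) ℤ.- + bit a) (+ bit d′)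
step-sound false false false refl = inj₁ refl , refl
step-sound true  true  false refl = inj₁ refl , refl
step-sound false true  false refl = inj₂ refl , refl
step-sound true  false true  refl = inj₁ refl , refl

step-complete : ∀ a c d′ → LocallyElementary (+ (bit c ℕ.+ bit d′) ℤ.- + bit a) (+ bit d′) →
  ∃ λ d → step a c d′ ≡ just d
step-complete false false false _              = false , refl
step-complete true  true  false _              = false , refl
step-complete false true  false _              = true  , refl
step-complete true  false true  _              = false , refl
step-complete true  false false (inj₁ () , _)
step-complete true  false false (inj₂ () , _)
step-complete false false true  (_ , ())
step-complete false true  true  (inj₁ () , _)
step-complete false true  true  (inj₂ () , _)
step-complete true  true  true  (_ , ())

elementary⇒accepted : ∀ {n} (x z : Subset n) → Elementary x z → ∃ λ d → δ x z ≡ just d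
elementary⇒accepted []      []      _  = false , refl
elementary⇒accepted (a ∷ x) (c ∷ z) el with elementary⇒accepted x z (Elementary-tail a c x z el)
... | d′ , tail-accept rewrite tail-accept =
  step-complete a c d′ (subst₂ LocallyElementary (Δ₁-cons a c x z tail-accept)
                                                 (Δ₁-state x z tail-accept)
                                                 (Elementary-head a c x z el))

accepted⇒elementary : ∀ {n} (x z : Subset n) {d} → δ x z ≡ just d → Elementary x z
accepted⇒elementary []      []      _ = (λ ()) , (λ _ ())
accepted⇒elementary (a ∷ x) (c ∷ z) accept with δ x z in tail-accept
... | just d′ =
  Elementary-cons a c x z
    (subst₂ LocallyElementary (sym (Δ₁-cons a c x z tail-accept)) (sym (Δ₁-state x z tail-accept))
            (step-sound a c d′ accept))
    (accepted⇒elementary x z tail-accept)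

rejected-if-not-elementary : ∀ {n} (x z : Subset n) → ¬ Elementary x z → δ x z ≡ nothing
rejected-if-not-elementary x z ¬el with δ x z in accept
... | nothing = refl
... | just _  = contradiction (accepted⇒elementary x z accept) ¬el

candidate : ∀ {n} → Subset n → Subset n → ℤ
candidate x z = maybe′ (λ _ → sg x z) (+ 0) (δ x z)

endsIn : Maybe Bool → Bool → Bool
endsIn nothing  _ = false
endsIn (just d) e = does (d ≟ᵇ e)

term : ∀ {n} → Bool → Subset n → Subset n → Subset n → ℤ
term d x y z = if endsIn (δ x z) d ∧ does (z ≼? y) then sg x z else + 0

F : ∀ {n} → Bool → Subset n → Subset n → ℤ
F d x y = Σs (term d x y)

-- Since elementary pairs are comparable, the interval sum of the candidate is F₀ + F₁.
candidate-interval : ∀ {n} (x y : Subset n) →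
  Σs (restrict x y (candidate x)) ≡ F false x y ℤ.+ F true x y
candidate-interval {n} x y =
  trans (sum-cong split-term (allSubsets n)) (sum-+ (term false x y) (term true x y) (allSubsets n))
  where
  split-term : ∀ z → restrict x y (candidate x) z ≡ term false x y z ℤ.+ term true x y z
  split-term z rewrite does-≤L x z | does-≤L z y with δ x z in accept
  ... | nothing with does (x ≼? z) ∧ does (z ≼? y)
  ...   | true  = refl
  ...   | false = refl
  split-term z | just d rewrite dec-true (x ≼? z) (δ⇒≼ x z accept) with d | does (z ≼? y)
  ... | false | true  = sym (ℤP.+-identityʳ _)
  ... | false | false = refl
  ... | true  | true  = sym (ℤP.+-identityˡ _)
  ... | true  | false = refl

headSign : (a c d′ : Bool) → ℤ
headSign a c d′ = σ (bit c) ℤ.* σ (bit a) ℤ.* σ (bit d′)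

σ-+₃ : ∀ p q r → σ (p ℕ.+ q ℕ.+ r) ≡ σ p ℤ.* σ q ℤ.* σ r
σ-+₃ p q r = trans (σ-+ (p ℕ.+ q) r) (cong (ℤ._* σ r) (σ-+ p q))

-- Along a head step the sign factors: ρ gains #z on one side and #x on the other, and
-- #z = d′ + #x, so the two contributions of #x cancel.
sg-cons : ∀ {n} a c (x z : Subset n) d′ → size z ≡ bit d′ ℕ.+ size x →
  sg (a ∷ x) (c ∷ z) ≡ headSign a c d′ ℤ.* sg x z
sg-cons a c x z d′ sz = begin
  σ (bit c ℕ.+ size z ℕ.+ weight z) ℤ.* σ (bit a ℕ.+ size x ℕ.+ weight x)
    ≡⟨ cong₂ ℤ._*_ (trans (σ-+₃ (bit c) (size z) (weight z))
                          (cong (λ s → σ (bit c) ℤ.* s ℤ.* σ (weight z))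
                                (trans (cong σ sz) (σ-+ (bit d′) (size x)))))
                   (σ-+₃ (bit a) (size x) (weight x)) ⟩
  σ (bit c) ℤ.* (σ (bit d′) ℤ.* σ (size x)) ℤ.* σ (weight z)
    ℤ.* (σ (bit a) ℤ.* σ (size x) ℤ.* σ (weight x))
    ≡⟨ regroup (σ (bit c)) (σ (bit a)) (σ (bit d′)) (σ (size x)) (σ (weight z)) (σ (weight x)) ⟩
  headSign a c d′ ℤ.* sg x z ℤ.* (σ (size x) ℤ.* σ (size x))
    ≡⟨ cong (headSign a c d′ ℤ.* sg x z ℤ.*_) (σ-square (size x)) ⟩
  headSign a c d′ ℤ.* sg x z ℤ.* + 1
    ≡⟨ ℤP.*-identityʳ _ ⟩
  headSign a c d′ ℤ.* sg x z ∎
  where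
  regroup : ∀ c a d s wz wx →
    c ℤ.* (d ℤ.* s) ℤ.* wz ℤ.* (a ℤ.* s ℤ.* wx) ≡ c ℤ.* a ℤ.* d ℤ.* (wz ℤ.* wx) ℤ.* (s ℤ.* s)
  regroup = solve-∀

-- The factor relating a term of F d (a ∷ x) (b ∷ y) with head c, relative to a term of F d′ x y
-- (with #x = m, #y = k): the head step must end in d and respect the size condition at 1.
coeff : (d a b c d′ : Bool) → ℕ → ℕ → ℤ
coeff d a b c d′ m k =
  if endsIn (step a c d′) d ∧ (bit c ℕ.+ (bit d′ ℕ.+ m) ≤ᵇ bit b ℕ.+ k)
  then headSign a c d′ else + 0

if-∧-* : ∀ p q q′ r (s u v : ℤ) → q ≡ q′ → s ≡ u ℤ.* v →
  (if p ∧ (q ∧ r) then s else + 0) ≡ (if p ∧ q′ then u else + 0) ℤ.* (if r then v else + 0)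
if-∧-* false q q′    r     s u v refl _   = refl
if-∧-* true  false _ r     s u v refl _   = refl
if-∧-* true  true  _ false s u v refl _   = sym (ℤP.*-zeroʳ u)
if-∧-* true  true  _ true  s u v refl s≡uv = s≡uv

select : ∀ d′ (k : Bool → ℤ) r (v : ℤ) →
  k d′ ℤ.* (if r then v else + 0) ≡
  k false ℤ.* (if endsIn (just d′) false ∧ r then v else + 0)
    ℤ.+ k true ℤ.* (if endsIn (just d′) true ∧ r then v else + 0)
select false k r v = sym (trans (cong (ℤ._+_ (k false ℤ.* (if r then v else + 0)))
                                      (ℤP.*-zeroʳ (k true)))
                                (ℤP.+-identityʳ _))
select true  k r v = sym (trans (cong (ℤ._+ k true ℤ.* (if r then v else + 0))
                                      (ℤP.*-zeroʳ (k false)))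
                                (ℤP.+-identityˡ _))

term-cons : ∀ {n} d a b c (x y z : Subset n) →
  term d (a ∷ x) (b ∷ y) (c ∷ z) ≡
    coeff d a b c false (size x) (size y) ℤ.* term false x y z
      ℤ.+ coeff d a b c true (size x) (size y) ℤ.* term true x y z
term-cons d a b c x y z with δ x z in accept
... | nothing = sym (cong₂ ℤ._+_ (ℤP.*-zeroʳ (coeff d a b c false (size x) (size y)))
                                 (ℤP.*-zeroʳ (coeff d a b c true (size x) (size y))))
... | just d′ = trans
  (if-∧-* (endsIn (step a c d′) d) _ _ (does (z ≼? y)) _ _ _
          (cong (λ s → bit c ℕ.+ s ≤ᵇ size (b ∷ y)) (δ-size x z accept))
          (sg-cons a c x z d′ (δ-size x z accept)))
  (select d′ (λ e → coeff d a b c e (size x) (size y)) (does (z ≼? y)) (sg x z))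

headPart : ∀ {n} (d a b c : Bool) (x y : Subset n) → ℤ
headPart d a b c x y =
  coeff d a b c false (size x) (size y) ℤ.* F false x y
    ℤ.+ coeff d a b c true (size x) (size y) ℤ.* F true x y

F-cons : ∀ {n} d a b (x y : Subset n) →
  F d (a ∷ x) (b ∷ y) ≡ headPart d a b true x y ℤ.+ headPart d a b false x y
F-cons {n} d a b x y =
  trans (Σs-split (term d (a ∷ x) (b ∷ y))) (cong₂ ℤ._+_ (part true) (part false))
  where
  part : ∀ c → Σs (term d (a ∷ x) (b ∷ y) ∘ (c ∷_)) ≡ headPart d a b c x y
  part c = begin
    Σs (term d (a ∷ x) (b ∷ y) ∘ (c ∷_))
      ≡⟨ sum-cong (term-cons d a b c x y) (allSubsets n) ⟩
    Σs (λ z → k₀ ℤ.* term false x y z ℤ.+ k₁ ℤ.* term true x y z)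
      ≡⟨ sum-+ (λ z → k₀ ℤ.* term false x y z) (λ z → k₁ ℤ.* term true x y z) (allSubsets n) ⟩
    Σs (λ z → k₀ ℤ.* term false x y z) ℤ.+ Σs (λ z → k₁ ℤ.* term true x y z)
      ≡⟨ cong₂ ℤ._+_ (sum-* k₀ (term false x y) (allSubsets n))
                     (sum-* k₁ (term true x y) (allSubsets n)) ⟩
    headPart d a b c x y ∎
    where
    k₀ = coeff d a b c false (size x) (size y)
    k₁ = coeff d a b c true (size x) (size y)

coeff-fits : ∀ d a b c d′ m k → endsIn (step a c d′) d ≡ true →
  bit c ℕ.+ (bit d′ ℕ.+ m) ≤ bit b ℕ.+ k → coeff d a b c d′ m k ≡ headSign a c d′
coeff-fits d a b c d′ m k ends fits =
  cong₂ (λ p q → if p ∧ q then headSign a c d′ else + 0) ends (dec-true (_ ℕP.≤? _) fits)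

coeff-exceeds : ∀ d a b c d′ m k → ¬ (bit c ℕ.+ (bit d′ ℕ.+ m) ≤ bit b ℕ.+ k) →
  coeff d a b c d′ m k ≡ + 0
coeff-exceeds d a b c d′ m k exceeds =
  trans (cong (λ q → if endsIn (step a c d′) d ∧ q then headSign a c d′ else + 0)
              (dec-false (_ ℕP.≤? _) exceeds))
        (if-false (endsIn (step a c d′) d))
  where
  if-false : ∀ e → (if e ∧ false then headSign a c d′ else + 0) ≡ + 0
  if-false true  = refl
  if-false false = refl

-- The head recursion for (F₀, F₁), case by case on the head a of x.  In each case only the
-- coefficients of head steps ending in the required state survive.
module _ {n} (b : Bool) (x y : Subset n) where
  private
    F₀ F₁ : ℤ
    F₀ = F false x y
    F₁ = F true x y

  F₀-cons-false : size x ≤ size (b ∷ y) → F false (false ∷ x) (b ∷ y) ≡ F₀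
  F₀-cons-false fits = begin
    F false (false ∷ x) (b ∷ y)
      ≡⟨ F-cons false false b x y ⟩
    headPart false false b true x y ℤ.+ headPart false false b false x y
      ≡⟨ cong (λ k → + 0 ℤ.* F₀ ℤ.+ + 0 ℤ.* F₁ ℤ.+ (k ℤ.* F₀ ℤ.+ + 0 ℤ.* F₁))
              (coeff-fits false false b false false (size x) (size y) refl fits) ⟩
    + 0 ℤ.* F₀ ℤ.+ + 0 ℤ.* F₁ ℤ.+ (+ 1 ℤ.* F₀ ℤ.+ + 0 ℤ.* F₁)
      ≡⟨ collect F₀ F₁ ⟩
    F₀ ∎
    where
    collect : ∀ v₀ v₁ → + 0 ℤ.* v₀ ℤ.+ + 0 ℤ.* v₁ ℤ.+ (+ 1 ℤ.* v₀ ℤ.+ + 0 ℤ.* v₁) ≡ v₀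
    collect = solve-∀

  F₀-cons-true : suc (size x) ≤ size (b ∷ y) → F false (true ∷ x) (b ∷ y) ≡ F₀ ℤ.+ F₁
  F₀-cons-true fits = begin
    F false (true ∷ x) (b ∷ y)
      ≡⟨ F-cons false true b x y ⟩
    headPart false true b true x y ℤ.+ headPart false true b false x y
      ≡⟨ cong₂ (λ k k′ → k ℤ.* F₀ ℤ.+ + 0 ℤ.* F₁ ℤ.+ (+ 0 ℤ.* F₀ ℤ.+ k′ ℤ.* F₁))
               (coeff-fits false true b true false (size x) (size y) refl fits)
               (coeff-fits false true b false true (size x) (size y) refl fits) ⟩
    + 1 ℤ.* F₀ ℤ.+ + 0 ℤ.* F₁ ℤ.+ (+ 0 ℤ.* F₀ ℤ.+ + 1 ℤ.* F₁)
      ≡⟨ collect F₀ F₁ ⟩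
    F₀ ℤ.+ F₁ ∎
    where
    collect : ∀ v₀ v₁ → + 1 ℤ.* v₀ ℤ.+ + 0 ℤ.* v₁ ℤ.+ (+ 0 ℤ.* v₀ ℤ.+ + 1 ℤ.* v₁) ≡ v₀ ℤ.+ v₁
    collect = solve-∀

  -- No head step starting with 1 ∈ x can end in state 1.
  F₁-cons-true : F true (true ∷ x) (b ∷ y) ≡ + 0
  F₁-cons-true = trans (F-cons true true b x y) (collect F₀ F₁)
    where
    collect : ∀ v₀ v₁ → + 0 ℤ.* v₀ ℤ.+ + 0 ℤ.* v₁ ℤ.+ (+ 0 ℤ.* v₀ ℤ.+ + 0 ℤ.* v₁) ≡ + 0
    collect = solve-∀

  F₁-cons-false-fits : suc (size x) ≤ size (b ∷ y) → F true (false ∷ x) (b ∷ y) ≡ - F₀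
  F₁-cons-false-fits fits = begin
    F true (false ∷ x) (b ∷ y)
      ≡⟨ F-cons true false b x y ⟩
    headPart true false b true x y ℤ.+ headPart true false b false x y
      ≡⟨ cong (λ k → k ℤ.* F₀ ℤ.+ + 0 ℤ.* F₁ ℤ.+ (+ 0 ℤ.* F₀ ℤ.+ + 0 ℤ.* F₁))
              (coeff-fits true false b true false (size x) (size y) refl fits) ⟩
    - + 1 ℤ.* F₀ ℤ.+ + 0 ℤ.* F₁ ℤ.+ (+ 0 ℤ.* F₀ ℤ.+ + 0 ℤ.* F₁)
      ≡⟨ collect F₀ F₁ ⟩
    - F₀ ∎
    where
    collect : ∀ v₀ v₁ → - + 1 ℤ.* v₀ ℤ.+ + 0 ℤ.* v₁ ℤ.+ (+ 0 ℤ.* v₀ ℤ.+ + 0 ℤ.* v₁) ≡ - v₀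
    collect = solve-∀

  F₁-cons-false-exceeds : ¬ (suc (size x) ≤ size (b ∷ y)) → F true (false ∷ x) (b ∷ y) ≡ + 0
  F₁-cons-false-exceeds exceeds = begin
    F true (false ∷ x) (b ∷ y)
      ≡⟨ F-cons true false b x y ⟩
    headPart true false b true x y ℤ.+ headPart true false b false x y
      ≡⟨ cong (λ k → k ℤ.* F₀ ℤ.+ + 0 ℤ.* F₁ ℤ.+ (+ 0 ℤ.* F₀ ℤ.+ + 0 ℤ.* F₁))
              (coeff-exceeds true false b true false (size x) (size y) exceeds) ⟩
    + 0 ℤ.* F₀ ℤ.+ + 0 ℤ.* F₁ ℤ.+ (+ 0 ℤ.* F₀ ℤ.+ + 0 ℤ.* F₁)
      ≡⟨ collect F₀ F₁ ⟩
    + 0 ∎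
    where
    collect : ∀ v₀ v₁ → + 0 ℤ.* v₀ ℤ.+ + 0 ℤ.* v₁ ℤ.+ (+ 0 ℤ.* v₀ ℤ.+ + 0 ℤ.* v₁) ≡ + 0
    collect = solve-∀

data IntervalSums {n} (x y : Subset n) : Set where
  diagonal    : x ≡ y → F false x y ≡ + 1 → F true x y ≡ + 0 → IntervalSums x y
  alternating : x ≢ y → size x < size y → F false x y ≡ + 1 → F true x y ≡ - + 1 → IntervalSums x y
  vanishing   : x ≢ y → F false x y ≡ + 0 → F true x y ≡ + 0 → IntervalSums x y

interval-sums : ∀ {n} (x y : Subset n) → x ≼ y → IntervalSums x y
interval-sums []      []      _               = diagonal refl refl refl
interval-sums (a ∷ x) (b ∷ y) (head≤ , tail≤) with interval-sums x y tail≤ | a | b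
... | diagonal refl F₀≡1 _ | false | false =
  diagonal refl (trans (F₀-cons-false false x x head≤) F₀≡1)
                (F₁-cons-false-exceeds false x x ℕP.1+n≰n)
... | diagonal refl F₀≡1 _ | false | true =
  alternating (λ ()) ℕP.≤-refl (trans (F₀-cons-false true x x head≤) F₀≡1)
              (trans (F₁-cons-false-fits true x x ℕP.≤-refl) (cong -_ F₀≡1))
... | diagonal refl _ _ | true | false = contradiction head≤ ℕP.1+n≰n
... | diagonal refl F₀≡1 F₁≡0 | true | true =
  diagonal refl (trans (F₀-cons-true true x x head≤) (cong₂ ℤ._+_ F₀≡1 F₁≡0))
                (F₁-cons-true true x x)
... | alternating x≢y _ F₀≡1 F₁≡-1 | true | b =
  vanishing (x≢y ∘ VecP.∷-injectiveʳ) (trans (F₀-cons-true b x y head≤) (cong₂ ℤ._+_ F₀≡1 F₁≡-1))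
            (F₁-cons-true b x y)
... | alternating x≢y #x<#y F₀≡1 _ | false | b =
  alternating (x≢y ∘ VecP.∷-injectiveʳ) #x<#b∷y (trans (F₀-cons-false b x y head≤) F₀≡1)
              (trans (F₁-cons-false-fits b x y #x<#b∷y) (cong -_ F₀≡1))
  where #x<#b∷y = ℕP.≤-trans #x<#y (ℕP.m≤n+m (size y) (bit b))
... | vanishing x≢y F₀≡0 F₁≡0 | true | b =
  vanishing (x≢y ∘ VecP.∷-injectiveʳ) (trans (F₀-cons-true b x y head≤) (cong₂ ℤ._+_ F₀≡0 F₁≡0))
            (F₁-cons-true b x y)
... | vanishing x≢y F₀≡0 _ | false | b =
  vanishing (x≢y ∘ VecP.∷-injectiveʳ) (trans (F₀-cons-false b x y head≤) F₀≡0) F₁≡0′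
  where
  F₁≡0′ : F true (false ∷ x) (b ∷ y) ≡ + 0
  F₁≡0′ with suc (size x) ℕP.≤? size (b ∷ y)
  ... | yes fits    = trans (F₁-cons-false-fits b x y fits) (cong -_ F₀≡0)
  ... | no  exceeds = F₁-cons-false-exceeds b x y exceeds

interval-sum-vanishes : ∀ {n} (x y : Subset n) → x ≼ y → x ≢ y → F false x y ℤ.+ F true x y ≡ + 0
interval-sum-vanishes x y x≤y x≢y with interval-sums x y x≤y
... | diagonal x≡y _ _              = contradiction x≡y x≢y
... | alternating _ _ F₀≡1 F₁≡-1    = cong₂ ℤ._+_ F₀≡1 F₁≡-1
... | vanishing _ F₀≡0 F₁≡0         = cong₂ ℤ._+_ F₀≡0 F₁≡0

candidate-accepted : ∀ {n} (x z : Subset n) {d} → δ x z ≡ just d → candidate x z ≡ sg x z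
candidate-accepted x z accept = cong (maybe′ (λ _ → sg x z) (+ 0)) accept

candidate-rejected : ∀ {n} (x z : Subset n) → δ x z ≡ nothing → candidate x z ≡ + 0
candidate-rejected x z reject = cong (maybe′ (λ _ → sg x z) (+ 0)) reject

candidate-isMöbius : ∀ n → IsMöbius n candidate
candidate-isMöbius n = on-diagonal , off-order , interval-sums-vanish
  where
  on-diagonal : ∀ x → candidate x x ≡ + 1
  on-diagonal x = trans (candidate-accepted x x (δ-refl x)) (σ-square (weight x))

  off-order : ∀ x y → ¬ (x ≤L y) → candidate x y ≡ + 0
  off-order x y x≰y with δ x y in accept
  ... | nothing = refl
  ... | just _  = contradiction (≼⇒≤L (δ⇒≼ x y accept)) x≰y

  interval-sums-vanish : ∀ x y → x <L y → sumℤ (List.map (candidate x) (interval x y)) ≡ + 0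
  interval-sums-vanish x y (x≤y , x≢y) = begin
    sumℤ (List.map (candidate x) (interval x y)) ≡⟨ interval-sum x y (candidate x) ⟩
    Σs (restrict x y (candidate x))              ≡⟨ candidate-interval x y ⟩
    F false x y ℤ.+ F true x y                   ≡⟨ interval-sum-vanishes x y (≤L⇒≼ x≤y) x≢y ⟩
    + 0 ∎

-- Theorem 3.7.  By uniqueness μ is the candidate, which the automaton evaluates.
theorem3p7 : (n : ℕ) → n ≥ 1 → (μ : Subset n → Subset n → ℤ) → IsMöbius n μ →
    (S T : Subset n) →
      (Elementary S T → μ S T ≡ signρ S T) × (¬ Elementary S T → μ S T ≡ + 0)
theorem3p7 n _ μ μ-isMöbius S T = elementary-case , non-elementary-case
  where
  μ≡candidate : μ S T ≡ candidate S T
  μ≡candidate = möbius-unique μ-isMöbius (candidate-isMöbius n) S T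

  elementary-case : Elementary S T → μ S T ≡ signρ S T
  elementary-case el with elementary⇒accepted S T el
  ... | _ , accept = begin
    μ S T          ≡⟨ μ≡candidate ⟩
    candidate S T  ≡⟨ candidate-accepted S T accept ⟩
    sg S T         ≡⟨ sym (signρ≡sg S T) ⟩
    signρ S T      ∎

  non-elementary-case : ¬ Elementary S T → μ S T ≡ + 0
  non-elementary-case ¬el =
    trans μ≡candidate (candidate-rejected S T (rejected-if-not-elementary S T ¬el))
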